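{- Let $\mathcal{F}$ be the free non-symmetric operad on two binary generators $\alpha,\beta$, and let $\pi:\mathcal{F}\to\mathrm{CNCB}$ be the operad morphism with $\pi(\alpha)=\tau_{aaa}$ and $\pi(\beta)=\tau_{bab}$. Then $\pi$ induces an isomorphism from $\mathcal{F}/_{\equiv}$ onto the suboperad $\langle\tau_{aaa},\tau_{bab}\rangle$, where $\equiv$ is the smallest operad congruence of $\mathcal{F}$ containing $\beta\circ_1\beta\equiv\beta\circ_2\beta$.
   Context: A bicoloured noncrossing configuration (BNC) of size $n\ge2$ is a regular polygon with vertices $1,\dots,n+1$ (clockwise) with each arc $(i,j)$, $1\le i<j\le n+1$, coloured blue, red or uncoloured, such that no two coloured (blue or red) arcs cross and red arcs are diagonals. The edges are $(i,i+1)$ for $i\in[n]$ (the $i$-th edge), the base is $(1,n+1)$, and the other arcs are diagonals. There is also a unique BNC of size $1$, a single blue arc (its edge and base). $\mathrm{CNCB}$ is the non-symmetric operad of BNCs (arity = size, unit = the size-$1$ BNC) with composition $\mathfrak{C}\circ_i\mathfrak{D}$ ($\mathfrak{C}$ of size $n$, $\mathfrak{D}$ of size $m$) obtained by gluing the base of $\mathfrak{D}$ onto the $i$-th edge of $\mathfrak{C}$. Vertex $j$ of $\mathfrak{C}$ goes to $j$ if $j\le i$ and to $j+m-1$ otherwise, and vertex $\ell$ of $\mathfrak{D}$ goes to $i+\ell-1$. All other arcs keep their colours. The arc $(i,i+m)$ is red if the $i$-th edge of $\mathfrak{C}$ and the base of $\mathfrak{D}$ are both uncoloured, blue if both are blue,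 and uncoloured otherwise. All remaining arcs are uncoloured. For $x,y,z\in\{a,b\}$, $\tau_{xyz}$ is the BNC of size $2$ (a triangle, which has no diagonals) whose first edge $(1,2)$, base $(1,3)$ and second edge $(2,3)$ are respectively coloured $x,y,z$, where $a$ means blue and $b$ means uncoloured. $\langle G\rangle$ denotes the smallest suboperad of $\mathrm{CNCB}$ containing $G$. -}

module Defs where

open import Data.Nat using (ℕ; zero; suc; _+_; _∸_; _≤_; _<_; _≤ᵇ_; _≡ᵇ_)
open import Data.Bool using (Bool; true; false; if_then_else_; _∧_; _∨_)
open import Data.Product using (_×_; Σ; ∃; _,_)
open import Data.Sum using (_⊎_)
open import Relation.Binary.PropositionalEquality using (_≡_)

data Colour : Set where
  blue red none : Colour

-- A configuration of size n: arc (p , q) with 1 ≤ p < q ≤ n + 1 has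
-- colour  col p q.  Values outside this range are irrelevant.
record Config : Set where
  constructor mkConfig
  field
    size : ℕ
    col  : ℕ → ℕ → Colour
open Config public

_≋_ : Config → Config → Set
C ≋ D = (size C ≡ size D) ×
        (∀ p q → 1 ≤ p → p < q → q ≤ suc (size C) → col C p q ≡ col D p q)

Crossing : ℕ → ℕ → ℕ → ℕ → Set
Crossing p q r s = (p < r × r < q × q < s) ⊎ (r < p × p < s × s < q)

coloured : Colour → Set
coloured none = Data.Empty.⊥ where import Data.Empty
coloured _    = Data.Unit.⊤ where import Data.Unit

-- Validity of a configuration as a BNC (recorded for documentation; the
-- main statement does not need it, since all objects considered are
-- built from the generators by composition).
IsBNC : Config → Set
IsBNC C =
  (1 ≤ size C) ×
  ((∀ p q r s → 1 ≤ p → p < q → q ≤ suc (size C) →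
                1 ≤ r → r < s → s ≤ suc (size C) →
                coloured (col C p q) → coloured (col C r s) →
                Crossing p q r s → Data.Empty.⊥) ×
   (∀ p q → 1 ≤ p → p < q → q ≤ suc (size C) → col C p q ≡ red →
            (suc p < q) × ((p ≡ 1 × q ≡ suc (size C)) → Data.Empty.⊥)))
  where import Data.Empty

-- colour of the glued arc (i, i+m)
merge : Colour → Colour → Colour
merge none none = red
merge blue blue = blue
merge _    _    = none

-- Partial composition  C ∘⟨ i ⟩ D : glue the base of D onto the i-th edge of C.
_∘⟨_⟩_ : Config → ℕ → Config → Config
C ∘⟨ i ⟩ D = mkConfig (size C + size D ∸ 1) c
  where
  m = size D
  inImg : ℕ → Bool
  inImg x = (x ≤ᵇ i) ∨ ((i + m) ≤ᵇ x)
  pre : ℕ → ℕ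
  pre x = if x ≤ᵇ i then x else x ∸ (m ∸ 1)
  c : ℕ → ℕ → Colour
  c p q =
    if (p ≡ᵇ i) ∧ (q ≡ᵇ (i + m)) then merge (col C i (suc i)) (col D 1 (suc m))
    else if (i ≤ᵇ p) ∧ (q ≤ᵇ (i + m)) then col D (suc (p ∸ i)) (suc (q ∸ i))
    else if inImg p ∧ inImg q then col C (pre p) (pre q)
    else none

unitC : Config
unitC = mkConfig 1 c
  where
  c : ℕ → ℕ → Colour
  c p q = if (p ≡ᵇ 1) ∧ (q ≡ᵇ 2) then blue else none

-- τ x y z : triangle with first edge (1,2), base (1,3), second edge (2,3)
-- coloured x, y, z respectively.
τ : Colour → Colour → Colour → Config
τ x y z = mkConfig 2 c
  where
  c : ℕ → ℕ → Colour
  c p q = if (p ≡ᵇ 1) ∧ (q ≡ᵇ 2) then x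
          else if (p ≡ᵇ 1) ∧ (q ≡ᵇ 3) then y
          else if (p ≡ᵇ 2) ∧ (q ≡ᵇ 3) then z
          else none

-- a = blue, b = uncoloured
τaaa τbab : Config
τaaa = τ blue blue blue
τbab = τ none blue none

data InGen : Config → Set where
  gen-unit : InGen unitC
  gen-aaa  : InGen τaaa
  gen-bab  : InGen τbab
  gen-comp : ∀ {C D} i → 1 ≤ i → i ≤ size C → InGen C → InGen D → InGen (C ∘⟨ i ⟩ D)
  gen-resp : ∀ {C D} → C ≋ D → InGen C → InGen D

data Tree : Set where
  leaf : Tree
  α β  : Tree → Tree → Tree

arity : Tree → ℕ
arity leaf    = 1
arity (α s t) = arity s + arity t
arity (β s t) = arity s + arity t

_∘F⟨_⟩_ : Tree → ℕ → Tree → Tree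
leaf    ∘F⟨ i ⟩ t = if i ≡ᵇ 1 then t else leaf
(α l r) ∘F⟨ i ⟩ t = if i ≤ᵇ arity l then α (l ∘F⟨ i ⟩ t) r else α l (r ∘F⟨ i ∸ arity l ⟩ t)
(β l r) ∘F⟨ i ⟩ t = if i ≤ᵇ arity l then β (l ∘F⟨ i ⟩ t) r else β l (r ∘F⟨ i ∸ arity l ⟩ t)

αF βF : Tree
αF = α leaf leaf
βF = β leaf leaf

data _≡F_ : Tree → Tree → Set where
  rel   : (βF ∘F⟨ 1 ⟩ βF) ≡F (βF ∘F⟨ 2 ⟩ βF)
  refl' : ∀ {s} → s ≡F s
  sym'  : ∀ {s t} → s ≡F t → t ≡F s
  trans' : ∀ {s t u} → s ≡F t → t ≡F u → s ≡F u
  comp' : ∀ {s s' t t'} i → 1 ≤ i → i ≤ arity s →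
          s ≡F s' → t ≡F t' → (s ∘F⟨ i ⟩ t) ≡F (s' ∘F⟨ i ⟩ t')

π : Tree → Config
π leaf    = unitC
π (α s t) = (τaaa ∘⟨ 2 ⟩ π t) ∘⟨ 1 ⟩ π s
π (β s t) = (τbab ∘⟨ 2 ⟩ π t) ∘⟨ 1 ⟩ π s

-- The picture π t of a tree is recognised from its root: if t = g(l, r) with l of arity a and r of
-- arity b, then π t is a node configuration: the arcs (1, a+1) and (a+1, a+b+1) have the colour
-- of g (blue for α, uncoloured for β), the base is blue, the arcs inside the vertex ranges [1, a+1] and
-- [a+1, a+b+1] are those of π l and π r, and every other arc is uncoloured. A node configuration is
-- determined by its edge colour and its parts, and grafting into one of its parts gives again a node
-- configuration. Hence π is an operad morphism; it respects ≡F because both sides of β ∘₁ β ≡ β ∘₂ β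
-- have only their base coloured, and its image is ⟨τaaa, τbab⟩.
--
-- Conversely, every tree is ≡F to a normal one, in which no β-node has a β-node as left child. If s and
-- t are normal and π s ≋ π t, the two node structures of the common picture have the same split vertex:
-- otherwise a blue arc of one of them (an edge of an α-root, or an edge of the α-rooted left child of a
-- β-root) would cross the split vertex of the other, where arcs are uncoloured. Then the edge colours and
-- the parts agree, and by induction s ≡ t.

module Submission where

open import Defs
open import Data.Bool using (true; false; _∧_)
open import Data.Empty using (⊥; ⊥-elim)
open import Data.Nat
open import Data.Nat.Properties
open import Algebra.Properties.CommutativeSemigroup +-commutativeSemigroup using (xy∙z≈xz∙y)
open import Data.Product using (_×_; _,_; proj₁; Σ; ∃-syntax)
open import Data.Unit using (⊤; tt)
open import Function using (_∘_)
open import Function.Bundles using (_⇔_; mk⇔)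
open import Relation.Binary.Bundles using (Setoid)
open import Relation.Binary.Definitions using (Tri; tri<; tri≈; tri>)
open import Relation.Binary.PropositionalEquality
import Relation.Binary.Reasoning.Setoid as SetoidReasoning
open import Relation.Nullary using (¬_; yes; no)
open import Relation.Nullary.Decidable using (_×-dec_)

≤ᵇ-true : ∀ {m n} → m ≤ n → (m ≤ᵇ n) ≡ true
≤ᵇ-true {m} {n} m≤n with m ≤ᵇ n | ≤⇒≤ᵇ m≤n
... | true | _ = refl

≤ᵇ-false : ∀ {m n} → ¬ m ≤ n → (m ≤ᵇ n) ≡ false
≤ᵇ-false {m} {n} m≰n with m ≤ᵇ n | ≤ᵇ⇒≤ m n
... | true  | ≤ᵇ⇒m≤n = ⊥-elim (m≰n (≤ᵇ⇒m≤n _))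
... | false | _ = refl

≡ᵇ-true : ∀ {m n} → m ≡ n → (m ≡ᵇ n) ≡ true
≡ᵇ-true {m} {n} m≡n with m ≡ᵇ n | ≡⇒≡ᵇ m n m≡n
... | true | _ = refl

≡ᵇ-false : ∀ {m n} → m ≢ n → (m ≡ᵇ n) ≡ false
≡ᵇ-false {m} {n} m≢n with m ≡ᵇ n | ≡ᵇ⇒≡ m n
... | true  | ≡ᵇ⇒m≡n = ⊥-elim (m≢n (≡ᵇ⇒m≡n _))
... | false | _ = refl

≡ᵇ-∧-false : ∀ {m m′ n n′} → ¬ (m ≡ m′ × n ≡ n′) → ((m ≡ᵇ m′) ∧ (n ≡ᵇ n′)) ≡ false
≡ᵇ-∧-false {m} {m′} ne with m ≟ m′
... | yes m≡m′ rewrite ≡ᵇ-true m≡m′ = ≡ᵇ-false (λ n≡n′ → ne (m≡m′ , n≡n′))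
... | no m≢m′  rewrite ≡ᵇ-false m≢m′ = refl

≤ᵇ-∧-false : ∀ {m m′ n n′} → ¬ (m ≤ m′ × n ≤ n′) → ((m ≤ᵇ m′) ∧ (n ≤ᵇ n′)) ≡ false
≤ᵇ-∧-false {m} {m′} ne with m ≤? m′
... | yes m≤m′ rewrite ≤ᵇ-true m≤m′ = ≤ᵇ-false (λ n≤n′ → ne (m≤m′ , n≤n′))
... | no m≰m′  rewrite ≤ᵇ-false m≰m′ = refl

-- Where the arc (p, q) of C ∘⟨ i ⟩ D lies when size D = suc k: vertex suc u of D becomes i + u and every
-- vertex v > i of C becomes v + k, so the arc is the glued arc, an arc of D, an arc of C, or it crosses
-- one end of the image of D.
data Position (i k p q : ℕ) : Set where
  glued     : p ≡ i → q ≡ i + suc k → Position i k p q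
  inside    : ∀ u v → p ≡ i + u → q ≡ i + v → u < v → v ≤ suc k → ¬ (u ≡ 0 × v ≡ suc k) →
              Position i k p q
  before    : p < q → q ≤ i → Position i k p q
  around    : ∀ q′ → q ≡ q′ + k → p ≤ i → i < q′ → ¬ (p ≡ i × q′ ≡ suc i) → Position i k p q
  after     : ∀ p′ q′ → p ≡ p′ + k → q ≡ q′ + k → i < p′ → p′ < q′ → Position i k p q
  crossingˡ : p < i → i < q → q < i + suc k → Position i k p q
  crossingʳ : i < p → p < i + suc k → i + suc k < q → Position i k p q

∘-colour : ∀ (C D : Config) {i k p q} → Position i k p q → Colour
∘-colour C D {i} (glued _ _)              = merge (col C i (suc i)) (col D 1 (suc (size D)))
∘-colour C D (inside u v _ _ _ _ _)       = col D (suc u) (suc v)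
∘-colour C D {p = p} {q} (before _ _)     = col C p q
∘-colour C D {p = p} (around q′ _ _ _ _)  = col C p q′
∘-colour C D (after p′ q′ _ _ _ _)        = col C p′ q′
∘-colour C D (crossingˡ _ _ _)            = none
∘-colour C D (crossingʳ _ _ _)            = none

col-∘ : ∀ C D {i k p q} → size D ≡ suc k → (pos : Position i k p q) →
        col (C ∘⟨ i ⟩ D) p q ≡ ∘-colour C D pos
col-∘ C D {i} {k} eqD (glued refl refl)
  rewrite eqD | ≡ᵇ-true {i} refl | ≡ᵇ-true {i + suc k} refl = refl
col-∘ C D {i} {k} eqD (inside u v refl refl u<v v≤ ne)
  rewrite eqD
        | ≡ᵇ-∧-false {i + u} {i} {i + v} {i + suc k}
            (λ (e₁ , e₂) → ne (+-cancelˡ-≡ i u 0 (trans e₁ (sym (+-identityʳ i))) , +-cancelˡ-≡ i v (suc k) e₂))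
        | ≤ᵇ-true (m≤m+n i u) | ≤ᵇ-true (+-monoʳ-≤ i v≤)
        | m+n∸m≡n i u | m+n∸m≡n i v = refl
col-∘ C D {i} {k} {p} {q} eqD (before p<q q≤i)
  rewrite eqD
        | ≡ᵇ-false (<⇒≢ (<-≤-trans p<q q≤i))
        | ≤ᵇ-false (<⇒≱ (<-≤-trans p<q q≤i))
        | ≤ᵇ-true (<⇒≤ (<-≤-trans p<q q≤i)) | ≤ᵇ-true q≤i = refl
col-∘ C D {i} {k} {p} eqD (around q′ refl p≤i i<q′ ne)
  rewrite eqD
        | ≡ᵇ-∧-false {p} {i} {q′ + k} {i + suc k}
            (λ (e₁ , e₂) → ne (e₁ , +-cancelʳ-≡ k q′ (suc i) (trans e₂ (+-suc i k))))
        | ≤ᵇ-∧-false {i} {p} {q′ + k} {i + suc k}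
            (λ (i≤p , le) → ne (≤-antisym p≤i i≤p ,
               ≤-antisym (+-cancelʳ-≤ k q′ (suc i) (subst (q′ + k ≤_) (+-suc i k) le)) i<q′))
        | ≤ᵇ-true p≤i
        | ≤ᵇ-false {q′ + k} {i} (<⇒≱ (<-≤-trans i<q′ (m≤m+n q′ k)))
        | ≤ᵇ-true {i + suc k} {q′ + k} (subst (_≤ q′ + k) (sym (+-suc i k)) (+-monoˡ-≤ k i<q′))
        | m+n∸n≡m q′ k = refl
col-∘ C D {i} {k} eqD (after p′ q′ refl refl i<p′ p′<q′)
  rewrite eqD
        | ≡ᵇ-false {p′ + k} {i} (>⇒≢ (<-≤-trans i<p′ (m≤m+n p′ k)))
        | ≤ᵇ-true {i} {p′ + k} (<⇒≤ (<-≤-trans i<p′ (m≤m+n p′ k)))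
        | ≤ᵇ-false {q′ + k} {i + suc k}
            (λ le → <⇒≱ (≤-<-trans i<p′ p′<q′)
                         (+-cancelʳ-≤ k q′ (suc i) (subst (q′ + k ≤_) (+-suc i k) le)))
        | ≤ᵇ-false {p′ + k} {i} (<⇒≱ (<-≤-trans i<p′ (m≤m+n p′ k)))
        | ≤ᵇ-false {q′ + k} {i} (<⇒≱ (<-≤-trans (<-trans i<p′ p′<q′) (m≤m+n q′ k)))
        | ≤ᵇ-true {i + suc k} {p′ + k} (subst (_≤ p′ + k) (sym (+-suc i k)) (+-monoˡ-≤ k i<p′))
        | ≤ᵇ-true {i + suc k} {q′ + k}
            (subst (_≤ q′ + k) (sym (+-suc i k)) (+-monoˡ-≤ k (<-trans i<p′ p′<q′)))
        | m+n∸n≡m p′ k | m+n∸n≡m q′ k = refl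
col-∘ C D {i} {k} {p} {q} eqD (crossingˡ p<i i<q q<i+m)
  rewrite eqD
        | ≡ᵇ-false (<⇒≢ p<i) | ≤ᵇ-false (<⇒≱ p<i) | ≤ᵇ-true (<⇒≤ p<i)
        | ≤ᵇ-false (<⇒≱ i<q) | ≤ᵇ-false (<⇒≱ q<i+m) = refl
col-∘ C D {i} {k} {p} {q} eqD (crossingʳ i<p p<i+m i+m<q)
  rewrite eqD
        | ≡ᵇ-false (>⇒≢ i<p) | ≤ᵇ-true (<⇒≤ i<p) | ≤ᵇ-false (<⇒≱ i+m<q)
        | ≤ᵇ-false (<⇒≱ i<p) | ≤ᵇ-false (<⇒≱ p<i+m) = refl

≡suc-pred : ∀ {n} → 1 ≤ n → n ≡ suc (pred n)
≡suc-pred (s≤s _) = refl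

shifted-preimage : ∀ i k {q} → i + suc k ≤ q → ∃[ q′ ] (q ≡ q′ + k × i < q′)
shifted-preimage i k {q} le =
  q ∸ k , sym (m∸n+n≡m k≤q) , m+n≤o⇒m≤o∸n (suc i) (subst (_≤ q) (+-suc i k) le)
  where k≤q = ≤-trans (≤-trans (n≤1+n k) (m≤n+m (suc k) i)) le

position : ∀ i k {p q} → p < q → Position i k p q
position i k {p} {q} p<q with i ≤? p
... | yes i≤p with q ≤? i + suc k
...   | yes q≤ with (p ≟ i) ×-dec (q ≟ i + suc k)
...     | yes (p≡i , q≡) = glued p≡i q≡
...     | no ne = inside (p ∸ i) (q ∸ i) (sym (m+[n∸m]≡n i≤p)) (sym (m+[n∸m]≡n i≤q))
                    (∸-monoˡ-< p<q i≤p) (m≤n+o⇒m∸n≤o q i q≤)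
                    (λ (u≡0 , v≡) →
                       ne (trans (sym (m+[n∸m]≡n i≤p)) (trans (cong (i +_) u≡0) (+-identityʳ i)) ,
                           trans (sym (m+[n∸m]≡n i≤q)) (cong (i +_) v≡)))
  where i≤q = ≤-trans i≤p (<⇒≤ p<q)
position i k {p} {q} p<q | yes i≤p | no q≰ with shifted-preimage i k (<⇒≤ (≰⇒> q≰))
... | q′ , q≡ , i<q′ with i + suc k ≤? p
...   | yes i+m≤p with shifted-preimage i k i+m≤p
...     | p′ , p≡ , i<p′ = after p′ q′ p≡ q≡ i<p′ (+-cancelʳ-< k p′ q′ (subst₂ _<_ p≡ q≡ p<q))
position i k {p} {q} p<q | yes i≤p | no q≰ | q′ , q≡ , i<q′ | no i+m≰p with p ≟ i
...     | yes p≡i = around q′ q≡ (≤-reflexive p≡i) i<q′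
                      (λ (_ , q′≡) → q≰ (≤-reflexive (trans q≡ (trans (cong (_+ k) q′≡) (sym (+-suc i k))))))
...     | no p≢i = crossingʳ (≤∧≢⇒< i≤p (p≢i ∘ sym)) (≰⇒> i+m≰p) (≰⇒> q≰)
position i k {p} {q} p<q | no i≰p with q ≤? i
... | yes q≤i = before p<q q≤i
... | no q≰i with q <? i + suc k
...   | yes q<i+m = crossingˡ (≰⇒> i≰p) (≰⇒> q≰i) q<i+m
...   | no q≮i+m with shifted-preimage i k (≮⇒≥ q≮i+m)
...     | q′ , q≡ , i<q′ =
  around q′ q≡ (<⇒≤ (≰⇒> i≰p)) i<q′ (λ (p≡i , _) → i≰p (≤-reflexive (sym p≡i)))

≋-refl : ∀ {C} → C ≋ C
≋-refl = refl , λ _ _ _ _ _ → refl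

≋-sym : ∀ {C D} → C ≋ D → D ≋ C
≋-sym (eq , f) = sym eq , λ p q 1≤p p<q q≤ → sym (f p q 1≤p p<q (subst (λ n → q ≤ suc n) (sym eq) q≤))

≋-trans : ∀ {C D E} → C ≋ D → D ≋ E → C ≋ E
≋-trans (eq , f) (eq′ , f′) =
  trans eq eq′ , λ p q 1≤p p<q q≤ →
    trans (f p q 1≤p p<q q≤) (f′ p q 1≤p p<q (subst (λ n → q ≤ suc n) eq q≤))

≋-setoid : Setoid _ _
≋-setoid = record
  { Carrier       = Config
  ; _≈_           = _≋_
  ; isEquivalence = record { refl = ≋-refl ; sym = ≋-sym ; trans = ≋-trans }
  }

≋-col : ∀ {C C′ n p q} → C ≋ C′ → size C ≡ n → 1 ≤ p → p < q → q ≤ suc n → col C p q ≡ col C′ p q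
≋-col {q = q} (_ , f) eq 1≤p p<q q≤ = f _ _ 1≤p p<q (subst (λ m → q ≤ suc m) (sym eq) q≤)

∘-size : ∀ {C D i k} → size D ≡ suc k → size (C ∘⟨ i ⟩ D) ≡ size C + k
∘-size {C} {k = k} eqD rewrite eqD = cong (_∸ 1) (+-suc (size C) k)

∘-resp-≋ : ∀ {C C′ D D′ i k} → C ≋ C′ → D ≋ D′ → size D ≡ suc k → 1 ≤ i → i ≤ size C →
           (C ∘⟨ i ⟩ D) ≋ (C′ ∘⟨ i ⟩ D′)
∘-resp-≋ {C} {C′} {D} {D′} {i} {k} (eC , fC) (eD , fD) eqD 1≤i i≤n =
  cong₂ (λ a b → a + b ∸ 1) eC eD , λ p q 1≤p p<q q≤ →
    let pos = position i k p<q in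
    trans (col-∘ C D eqD pos)
          (trans (agree pos (subst (λ n → q ≤ suc n) (∘-size {C} {D} {i} eqD) q≤) 1≤p)
                 (sym (col-∘ C′ D′ (trans (sym eD) eqD) pos)))
  where
  agree : ∀ {p q} (pos : Position i k p q) → q ≤ suc (size C + k) → 1 ≤ p →
          ∘-colour C D pos ≡ ∘-colour C′ D′ pos
  agree (glued _ _) _ _ =
    cong₂ merge (fC i (suc i) 1≤i ≤-refl (s≤s i≤n))
                (trans (fD 1 (suc (size D)) ≤-refl (s≤s (subst (1 ≤_) (sym eqD) (s≤s z≤n))) ≤-refl)
                       (cong (λ n → col D′ 1 (suc n)) eD))
  agree (inside u v _ _ u<v v≤ _) _ _ =
    fD (suc u) (suc v) (s≤s z≤n) (s≤s u<v) (s≤s (subst (v ≤_) (sym eqD) v≤))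
  agree {p} {q} (before p<q q≤i) _ 1≤p = fC p q 1≤p p<q (≤-trans q≤i (≤-trans i≤n (n≤1+n _)))
  agree {p} (around q′ refl p≤i i<q′ _) q≤ 1≤p =
    fC p q′ 1≤p (≤-<-trans p≤i i<q′) (+-cancelʳ-≤ k q′ (suc (size C)) q≤)
  agree (after p′ q′ refl refl i<p′ p′<q′) q≤ _ =
    fC p′ q′ (≤-trans (s≤s z≤n) i<p′) p′<q′ (+-cancelʳ-≤ k q′ (suc (size C)) q≤)
  agree (crossingˡ _ _ _) _ _ = refl
  agree (crossingʳ _ _ _) _ _ = refl

HasBlueBase : Config → Set
HasBlueBase D = col D 1 (suc (size D)) ≡ blue

∘-identityˡ : ∀ {D k} → size D ≡ suc k → HasBlueBase D → (unitC ∘⟨ 1 ⟩ D) ≋ D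
∘-identityˡ {D} {k} eqD base = refl , λ p q 1≤p p<q q≤ →
  trans (col-∘ unitC D eqD (position 1 k p<q))
        (agree (position 1 k p<q) 1≤p (subst (λ n → q ≤ suc n) eqD q≤))
  where
  agree : ∀ {p q} (pos : Position 1 k p q) → 1 ≤ p → q ≤ suc (suc k) →
          ∘-colour unitC D pos ≡ col D p q
  agree (glued refl refl) _ _ rewrite base = sym (subst (λ n → col D 1 (suc n) ≡ blue) eqD base)
  agree (inside u v refl refl _ _ _) _ _ = refl
  agree (before p<q q≤1) 1≤p _ = ⊥-elim (<⇒≱ (≤-<-trans 1≤p p<q) q≤1)
  agree (around q′ refl p≤1 1<q′ ne) 1≤p q≤ =
    ⊥-elim (ne (≤-antisym p≤1 1≤p , ≤-antisym (+-cancelʳ-≤ k q′ 2 q≤) 1<q′))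
  agree (after p′ q′ refl refl 1<p′ p′<q′) _ q≤ =
    ⊥-elim (<⇒≱ (≤-<-trans 1<p′ p′<q′) (+-cancelʳ-≤ k q′ 2 q≤))
  agree (crossingˡ p<1 _ _) 1≤p _ = ⊥-elim (<⇒≱ p<1 1≤p)
  agree (crossingʳ _ _ 1+m<q) _ q≤ = ⊥-elim (<⇒≱ 1+m<q q≤)

record NonBaseArc (n p q : ℕ) : Set where
  constructor nonBase
  field
    1≤p   : 1 ≤ p
    p<q   : p < q
    q≤    : q ≤ suc n
    ≢base : ¬ (p ≡ 1 × q ≡ suc n)

≋-arc : ∀ {C C′ n p q} → C ≋ C′ → size C ≡ n → NonBaseArc n p q → col C p q ≡ col C′ p q
≋-arc C≋ eq (nonBase 1≤p p<q q≤ _) = ≋-col C≋ eq 1≤p p<q q≤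

-- The non-base arcs of an (n + 1)-gon L reappear in E shifted by a; the base of L may be recoloured in E.
Embedded : ℕ → ℕ → Config → Config → Set
Embedded a n L E = ∀ {p q} → NonBaseArc n p q → col E (a + p) (a + q) ≡ col L p q

shift : ∀ a {j k p q} → Position j k p q → Position (a + j) k (a + p) (a + q)
shift a {j} {k} (glued e₁ e₂) =
  glued (cong (a +_) e₁) (trans (cong (a +_) e₂) (sym (+-assoc a j (suc k))))
shift a {j} (inside u v e₁ e₂ u<v v≤ ne) =
  inside u v (trans (cong (a +_) e₁) (sym (+-assoc a j u))) (trans (cong (a +_) e₂) (sym (+-assoc a j v)))
         u<v v≤ ne
shift a (before p<q q≤j) = before (+-monoʳ-< a p<q) (+-monoʳ-≤ a q≤j)
shift a {j} {k} (around q′ e p≤j j<q′ ne) =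
  around (a + q′) (trans (cong (a +_) e) (sym (+-assoc a q′ k))) (+-monoʳ-≤ a p≤j) (+-monoʳ-< a j<q′)
         (λ (e₁ , e₂) → ne (+-cancelˡ-≡ a _ _ e₁ , +-cancelˡ-≡ a _ _ (trans e₂ (sym (+-suc a j)))))
shift a {k = k} (after p′ q′ e₁ e₂ j<p′ p′<q′) =
  after (a + p′) (a + q′)
        (trans (cong (a +_) e₁) (sym (+-assoc a p′ k))) (trans (cong (a +_) e₂) (sym (+-assoc a q′ k)))
        (+-monoʳ-< a j<p′) (+-monoʳ-< a p′<q′)
shift a {j} {k} {q = q} (crossingˡ p<j j<q q<j+m) =
  crossingˡ (+-monoʳ-< a p<j) (+-monoʳ-< a j<q)
            (subst (a + q <_) (sym (+-assoc a j (suc k))) (+-monoʳ-< a q<j+m))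
shift a {j} {k} {p} {q} (crossingʳ j<p p<j+m j+m<q) =
  crossingʳ (+-monoʳ-< a j<p) (subst (a + p <_) (sym (+-assoc a j (suc k))) (+-monoʳ-< a p<j+m))
            (subst (_< a + q) (sym (+-assoc a j (suc k))) (+-monoʳ-< a j+m<q))

embedded-∘-inside : ∀ {a n j k L E D} → Embedded a n L E → size D ≡ suc k → 1 ≤ j → j ≤ n →
             Embedded a (n + k) (L ∘⟨ j ⟩ D) (E ∘⟨ a + j ⟩ D)
embedded-∘-inside {a} {n} {j} {k} {L} {E} {D} emb eqD 1≤j j≤n arc@(nonBase 1≤p p<q q≤ ≢base) =
  trans (col-∘ E D eqD (shift a pos)) (trans (agree pos) (sym (col-∘ L D eqD pos)))
  where
  pos = position j k p<q
  agree : (pos : Position j k _ _) → ∘-colour E D (shift a pos) ≡ ∘-colour L D pos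
  agree (glued p≡j q≡) =
    cong (λ c → merge c (col D 1 (suc (size D))))
      (trans (cong (col E (a + j)) (sym (+-suc a j)))
             (emb (nonBase 1≤j ≤-refl (s≤s j≤n)
                    (λ (j≡1 , j≡n) → ≢base (trans p≡j j≡1 ,
                        trans q≡ (trans (+-suc j k) (cong (λ m → suc (m + k)) (suc-injective j≡n))))))))
  agree (inside _ _ _ _ _ _ _) = refl
  agree (before p<q q≤j) =
    emb (nonBase 1≤p p<q (≤-trans q≤j (≤-trans j≤n (n≤1+n n)))
                 (λ (_ , q≡) → <⇒≱ (s≤s j≤n) (subst (_≤ j) q≡ q≤j)))
  agree (around q′ refl p≤j j<q′ _) =
    emb (nonBase 1≤p (≤-<-trans p≤j j<q′) (+-cancelʳ-≤ k q′ (suc n) q≤)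
                 (λ (p≡1 , q′≡) → ≢base (p≡1 , cong (_+ k) q′≡)))
  agree (after p′ q′ refl refl j<p′ p′<q′) =
    emb (nonBase (≤-trans (s≤s z≤n) j<p′) p′<q′ (+-cancelʳ-≤ k q′ (suc n) q≤)
                 (λ (p′≡1 , _) → <⇒≱ (subst (j <_) p′≡1 j<p′) 1≤j))
  agree (crossingˡ _ _ _) = refl
  agree (crossingʳ _ _ _) = refl

embedded-∘-before : ∀ {a n i k L E D} → Embedded a n L E → size D ≡ suc k → a + n < i →
                    Embedded a n L (E ∘⟨ i ⟩ D)
embedded-∘-before {a} {n} {i} {E = E} {D} emb eqD a+n<i arc@(nonBase _ p<q q≤ _) =
  trans (col-∘ E D eqD (before (+-monoʳ-< a p<q)
                               (≤-trans (+-monoʳ-≤ a q≤) (subst (_≤ i) (sym (+-suc a n)) a+n<i))))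
        (emb arc)

embedded-∘-after : ∀ {a n i k R E D} → Embedded a n R E → size D ≡ suc k → i ≤ a →
                   Embedded (a + k) n R (E ∘⟨ i ⟩ D)
embedded-∘-after {a} {n} {i} {k} {E = E} {D} emb eqD i≤a {p} {q} arc@(nonBase 1≤p p<q _ _) =
  trans (col-∘ E D eqD (after (a + p) (a + q) (xy∙z≈xz∙y a k p) (xy∙z≈xz∙y a k q)
                              (≤-<-trans i≤a (m<m+n a 1≤p)) (+-monoʳ-< a p<q)))
        (emb arc)

-- E is L and R glued at the split vertex a + 1 under a triangle with edges coloured x and a blue base.
record IsNode (x : Colour) (a b : ℕ) (L R E : Config) : Set where
  field
    sizeˡ      : size L ≡ a
    sizeʳ      : size R ≡ b
    size≡      : size E ≡ a + b
    1≤a        : 1 ≤ a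
    1≤b        : 1 ≤ b
    left-edge  : col E 1 (suc a) ≡ x
    right-edge : col E (suc a) (suc (a + b)) ≡ x
    base       : col E 1 (suc (a + b)) ≡ blue
    left       : Embedded 0 a L E
    right      : Embedded a b R E
    crossing   : ∀ {p q} → NonBaseArc (a + b) p q → p < suc a → suc a < q → col E p q ≡ none

data NodeArc (a b : ℕ) : ℕ → ℕ → Set where
  leftEdge  : NodeArc a b 1 (suc a)
  rightEdge : NodeArc a b (suc a) (suc (a + b))
  baseArc   : NodeArc a b 1 (suc (a + b))
  inLeft    : ∀ {p q} → NonBaseArc a p q → NodeArc a b p q
  inRight   : ∀ {p q} → NonBaseArc b p q → NodeArc a b (a + p) (a + q)
  across    : ∀ {p q} → NonBaseArc (a + b) p q → p < suc a → suc a < q → NodeArc a b p q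

nodeArc : ∀ a b {p q} → 1 ≤ p → p < q → q ≤ suc (a + b) → NodeArc a b p q
nodeArc a b {p} {q} 1≤p p<q q≤ with q ≤? suc a
... | yes q≤a+1 with (p ≟ 1) ×-dec (q ≟ suc a)
...   | yes (refl , refl) = leftEdge
...   | no ne = inLeft (nonBase 1≤p p<q q≤a+1 ne)
nodeArc a b {p} {q} 1≤p p<q q≤ | no q≰a+1 with suc a ≤? p
...   | yes a<p with (p ≟ suc a) ×-dec (q ≟ suc (a + b))
...     | yes (refl , refl) = rightEdge
...     | no ne = subst₂ (NodeArc a b) (m+[n∸m]≡n a≤p) (m+[n∸m]≡n a≤q)
                    (inRight (nonBase (m<n⇒0<n∸m a<p) (∸-monoˡ-< p<q a≤p)
                                      (m≤n+o⇒m∸n≤o q a (subst (q ≤_) (sym (+-suc a b)) q≤))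
                                      (λ (e₁ , e₂) →
                                         ne (unshift a≤p e₁ (+-comm a 1) , unshift a≤q e₂ (+-suc a b)))))
  where
  a≤p = <⇒≤ a<p
  a≤q = ≤-trans a≤p (<⇒≤ p<q)
  unshift : ∀ {m n r} → a ≤ m → m ∸ a ≡ n → a + n ≡ r → m ≡ r
  unshift a≤m e e′ = trans (sym (m+[n∸m]≡n a≤m)) (trans (cong (a +_) e) e′)
nodeArc a b {p} {q} 1≤p p<q q≤ | no q≰a+1 | no a≮p with (p ≟ 1) ×-dec (q ≟ suc (a + b))
...     | yes (refl , refl) = baseArc
...     | no ne = across (nonBase 1≤p p<q q≤ ne) (≰⇒> a≮p) (≰⇒> q≰a+1)

module _ {x a b L R E} (N : IsNode x a b L R E) where
  open IsNode N

  IsNode-blueBase : HasBlueBase E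
  IsNode-blueBase = subst (λ n → col E 1 (suc n) ≡ blue) (sym size≡) base

  IsNode-nonempty : 1 ≤ size E
  IsNode-nonempty = subst (1 ≤_) (sym size≡) (≤-trans 1≤a (m≤m+n a b))

  IsNode-size≢1 : size E ≢ 1
  IsNode-size≢1 size≡1 = <⇒≢ (+-mono-≤ 1≤a 1≤b) (sym (trans (sym size≡) size≡1))

  IsNode-unique : ∀ {a′ b′ L′ R′ E′} → IsNode x a′ b′ L′ R′ E′ → L ≋ L′ → R ≋ R′ → E ≋ E′
  IsNode-unique {E′ = E′} N′ L≋ R≋
    with trans (sym sizeˡ) (trans (proj₁ L≋) (IsNode.sizeˡ N′))
       | trans (sym sizeʳ) (trans (proj₁ R≋) (IsNode.sizeʳ N′))
  ... | refl | refl = trans size≡ (sym N′.size≡) , λ p q 1≤p p<q q≤ →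
        agree (nodeArc a b 1≤p p<q (subst (λ n → q ≤ suc n) size≡ q≤))
    where
    module N′ = IsNode N′
    agree : ∀ {p q} → NodeArc a b p q → col E p q ≡ col E′ p q
    agree leftEdge  = trans left-edge (sym N′.left-edge)
    agree rightEdge = trans right-edge (sym N′.right-edge)
    agree baseArc   = trans base (sym N′.base)
    agree (inLeft arc)  = trans (left arc) (trans (≋-arc L≋ sizeˡ arc) (sym (N′.left arc)))
    agree (inRight arc) = trans (right arc) (trans (≋-arc R≋ sizeʳ arc) (sym (N′.right arc)))
    agree (across arc p<a+1 a+1<q) = trans (crossing arc p<a+1 a+1<q) (sym (N′.crossing arc p<a+1 a+1<q))

  IsNode-resp-parts : ∀ {L′ R′} → L ≋ L′ → R ≋ R′ → IsNode x a b L′ R′ E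
  IsNode-resp-parts L≋ R≋ = record
    { IsNode N
    ; sizeˡ = trans (sym (proj₁ L≋)) sizeˡ
    ; sizeʳ = trans (sym (proj₁ R≋)) sizeʳ
    ; left  = λ arc → trans (left arc) (≋-arc L≋ sizeˡ arc)
    ; right = λ arc → trans (right arc) (≋-arc R≋ sizeʳ arc)
    }

  IsNode-resp-≋ : ∀ {E′} → E ≋ E′ → IsNode x a b L R E′
  IsNode-resp-≋ {E′} E≋ = record
    { IsNode N
    ; size≡      = trans (sym (proj₁ E≋)) size≡
    ; left-edge  = trans (sym (at (s≤s z≤n) (s≤s 1≤a) (s≤s (m≤m+n a b)))) left-edge
    ; right-edge = trans (sym (at (s≤s z≤n) (s≤s (m<m+n a 1≤b)) ≤-refl)) right-edge
    ; base       = trans (sym (at (s≤s z≤n) (s≤s (≤-trans 1≤a (m≤m+n a b))) ≤-refl)) base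
    ; left       = λ arc@(nonBase 1≤p p<q q≤ _) →
                     trans (sym (at 1≤p p<q (≤-trans q≤ (s≤s (m≤m+n a b))))) (left arc)
    ; right      = λ {p} {q} arc@(nonBase 1≤p p<q q≤ _) →
                     trans (sym (at (≤-trans 1≤p (m≤n+m _ a)) (+-monoʳ-< a p<q)
                                    (subst (a + q ≤_) (+-suc a b) (+-monoʳ-≤ a q≤))))
                           (right arc)
    ; crossing   = λ arc p<a+1 a+1<q → trans (sym (≋-arc E≋ size≡ arc)) (crossing arc p<a+1 a+1<q)
    }
    where
    at : ∀ {p q} → 1 ≤ p → p < q → q ≤ suc (a + b) → col E p q ≡ col E′ p q
    at = ≋-col E≋ size≡

-- When the part receiving D is a single edge, that edge becomes the glued arc, coloured merge x blue.
module GraftLeft {x a b i k L R C D} (N : IsNode x a b L R C) (merge-x-blue : merge x blue ≡ x)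
                 (baseD : HasBlueBase D) (eqD : size D ≡ suc k) (1≤i : 1 ≤ i) (i≤a : i ≤ a) where
  open IsNode N

  left-edge′ : col (C ∘⟨ i ⟩ D) 1 (suc (a + k)) ≡ x
  left-edge′ with (i ≟ 1) ×-dec (a ≟ 1)
  ... | yes (refl , refl) =
    trans (col-∘ C D eqD (glued refl refl)) (trans (cong₂ merge left-edge baseD) merge-x-blue)
  ... | no ne = trans (col-∘ C D eqD (around (suc a) refl 1≤i (s≤s i≤a)
                                        (λ (1≡i , e) → ne (sym 1≡i , trans (suc-injective e) (sym 1≡i)))))
                      left-edge

  right-edge′ : col (C ∘⟨ i ⟩ D) (suc (a + k)) (suc ((a + k) + b)) ≡ x
  right-edge′ = trans (col-∘ C D eqD (after (suc a) (suc (a + b)) refl (cong suc (xy∙z≈xz∙y a k b))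
                                            (s≤s i≤a) (s≤s (m<m+n a 1≤b))))
                      right-edge

  base′ : col (C ∘⟨ i ⟩ D) 1 (suc ((a + k) + b)) ≡ blue
  base′ = trans (col-∘ C D eqD (around (suc (a + b)) (cong suc (xy∙z≈xz∙y a k b)) 1≤i
                                       (s≤s (≤-trans i≤a (m≤m+n a b)))
                                       (λ (_ , e) → <⇒≱ (m<m+n a 1≤b)
                                                         (subst (_≤ a) (sym (suc-injective e)) i≤a))))
                base

  i+m≤ : i + suc k ≤ suc (a + k)
  i+m≤ = subst (i + suc k ≤_) (+-suc a k) (+-monoˡ-≤ (suc k) i≤a)

  unshifted-bound : ∀ {q′} → q′ + k ≤ suc ((a + k) + b) → q′ ≤ suc (a + b)
  unshifted-bound {q′} le =
    +-cancelʳ-≤ k q′ (suc (a + b)) (subst (q′ + k ≤_) (cong suc (xy∙z≈xz∙y a k b)) le)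

  crossing′ : ∀ {p q} → NonBaseArc ((a + k) + b) p q → p < suc (a + k) → suc (a + k) < q →
              (pos : Position i k p q) → ∘-colour C D pos ≡ none
  crossing′ _ _ a+k+1<q (glued _ refl) = ⊥-elim (<⇒≱ a+k+1<q i+m≤)
  crossing′ _ _ a+k+1<q (inside _ v _ refl _ v≤ _) =
    ⊥-elim (<⇒≱ a+k+1<q (≤-trans (+-monoʳ-≤ i v≤) i+m≤))
  crossing′ _ _ a+k+1<q (before _ q≤i) =
    ⊥-elim (<⇒≱ a+k+1<q (≤-trans q≤i (≤-trans i≤a (≤-trans (m≤m+n a k) (n≤1+n _)))))
  crossing′ {p} (nonBase 1≤p _ q≤ ≢base) _ a+k+1<q (around q′ refl p≤i i<q′ _) =
    crossing (nonBase 1≤p (≤-<-trans p≤i i<q′) (unshifted-bound q≤)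
                      (λ (p≡1 , q′≡) →
                         ≢base (p≡1 , trans (cong (_+ k) q′≡) (cong suc (sym (xy∙z≈xz∙y a k b))))))
             (s≤s (≤-trans p≤i i≤a)) (+-cancelʳ-< k (suc a) q′ a+k+1<q)
  crossing′ (nonBase _ _ q≤ _) p<a+k+1 a+k+1<q (after p′ q′ refl refl i<p′ p′<q′) =
    crossing (nonBase (≤-trans (s≤s z≤n) i<p′) p′<q′ (unshifted-bound q≤)
                      (λ (p′≡1 , _) → <⇒≱ (subst (i <_) p′≡1 i<p′) 1≤i))
             (+-cancelʳ-< k p′ (suc a) p<a+k+1) (+-cancelʳ-< k (suc a) q′ a+k+1<q)
  crossing′ _ _ _ (crossingˡ _ _ _) = refl
  crossing′ _ _ _ (crossingʳ _ _ _) = refl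

  isNode : IsNode x (a + k) b (L ∘⟨ i ⟩ D) R (C ∘⟨ i ⟩ D)
  isNode = record
    { sizeˡ      = trans (∘-size {L} {D} {i} eqD) (cong (_+ k) sizeˡ)
    ; sizeʳ      = sizeʳ
    ; size≡      = trans (∘-size {C} {D} {i} eqD) (trans (cong (_+ k) size≡) (xy∙z≈xz∙y a b k))
    ; 1≤a        = ≤-trans 1≤a (m≤m+n a k)
    ; 1≤b        = 1≤b
    ; left-edge  = left-edge′
    ; right-edge = right-edge′
    ; base       = base′
    ; left       = embedded-∘-inside {0} {a} {i} {k} {L} {C} {D} left eqD 1≤i i≤a
    ; right      = embedded-∘-after {a} {b} {i} {k} {R} {C} {D} right eqD i≤a
    ; crossing   = λ arc p<a+k+1 a+k+1<q →
                     let pos = position i k (NonBaseArc.p<q arc) in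
                     trans (col-∘ C D eqD pos) (crossing′ arc p<a+k+1 a+k+1<q pos)
    }

module GraftRight {x a b j k L R C D} (N : IsNode x a b L R C) (merge-x-blue : merge x blue ≡ x)
                  (baseD : HasBlueBase D) (eqD : size D ≡ suc k) (1≤j : 1 ≤ j) (j≤b : j ≤ b) where
  open IsNode N

  a<i : a < a + j
  a<i = m<m+n a 1≤j

  i<a+b+1 : a + j < suc (a + b)
  i<a+b+1 = s≤s (+-monoʳ-≤ a j≤b)

  right-edge′ : col (C ∘⟨ a + j ⟩ D) (suc a) (suc (a + (b + k))) ≡ x
  right-edge′ with (j ≟ 1) ×-dec (b ≟ 1)
  ... | yes (refl , refl) =
    trans (col-∘ C D eqD (glued (sym (+-comm a 1))
                                (trans (sym (+-suc a (suc k))) (sym (+-assoc a 1 (suc k))))))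
          (trans (cong₂ merge (subst (λ n → col C n (suc (a + 1)) ≡ x) (sym (+-comm a 1)) right-edge) baseD)
                 merge-x-blue)
  ... | no ne =
    trans (col-∘ C D eqD (around (suc (a + b)) (cong suc (sym (+-assoc a b k))) a<i i<a+b+1
                            (λ (e₁ , e₂) → let j≡1 = +-cancelˡ-≡ a j 1 (trans (sym e₁) (sym (+-comm a 1))) in
                                            ne (j≡1 , trans (+-cancelˡ-≡ a b j (suc-injective e₂)) j≡1))))
          right-edge

  base′ : col (C ∘⟨ a + j ⟩ D) 1 (suc (a + (b + k))) ≡ blue
  base′ = trans (col-∘ C D eqD (around (suc (a + b)) (cong suc (sym (+-assoc a b k)))
                                       (≤-trans (s≤s z≤n) a<i) i<a+b+1
                                       (λ (1≡i , _) → <⇒≢ (+-mono-≤ 1≤a 1≤j) 1≡i)))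
                base

  unshifted-bound : ∀ {q′} → q′ + k ≤ suc (a + (b + k)) → q′ ≤ suc (a + b)
  unshifted-bound {q′} le =
    +-cancelʳ-≤ k q′ (suc (a + b)) (subst (q′ + k ≤_) (cong suc (sym (+-assoc a b k))) le)

  crossing′ : ∀ {p q} → NonBaseArc (a + (b + k)) p q → p < suc a → suc a < q →
              (pos : Position (a + j) k p q) → ∘-colour C D pos ≡ none
  crossing′ _ p<a+1 _ (glued refl _) = ⊥-elim (<⇒≱ p<a+1 a<i)
  crossing′ _ p<a+1 _ (inside u _ refl _ _ _ _) = ⊥-elim (<⇒≱ p<a+1 (≤-trans a<i (m≤m+n (a + j) u)))
  crossing′ {p} {q} (nonBase 1≤p p<q _ _) p<a+1 a+1<q (before _ q≤i) =
    crossing (nonBase 1≤p p<q (≤-trans q≤i (<⇒≤ i<a+b+1))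
                      (λ (_ , q≡) → <⇒≱ i<a+b+1 (subst (_≤ a + j) q≡ q≤i)))
             p<a+1 a+1<q
  crossing′ {p} (nonBase 1≤p _ q≤ ≢base) p<a+1 _ (around q′ refl p≤i i<q′ _) =
    crossing (nonBase 1≤p (≤-<-trans p≤i i<q′) (unshifted-bound q≤)
                      (λ (p≡1 , q′≡) → ≢base (p≡1 , trans (cong (_+ k) q′≡) (cong suc (+-assoc a b k)))))
             p<a+1 (≤-<-trans a<i i<q′)
  crossing′ _ p<a+1 _ (after p′ _ refl _ i<p′ _) =
    ⊥-elim (<⇒≱ p<a+1 (≤-trans (≤-trans a<i (<⇒≤ i<p′)) (m≤m+n p′ k)))
  crossing′ _ _ _ (crossingˡ _ _ _) = refl
  crossing′ _ _ _ (crossingʳ _ _ _) = refl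

  isNode : IsNode x a (b + k) L (R ∘⟨ j ⟩ D) (C ∘⟨ a + j ⟩ D)
  isNode = record
    { sizeˡ      = sizeˡ
    ; sizeʳ      = trans (∘-size {R} {D} {j} eqD) (cong (_+ k) sizeʳ)
    ; size≡      = trans (∘-size {C} {D} {a + j} eqD) (trans (cong (_+ k) size≡) (+-assoc a b k))
    ; 1≤a        = 1≤a
    ; 1≤b        = ≤-trans 1≤b (m≤m+n b k)
    ; left-edge  = trans (col-∘ C D eqD (before (s≤s 1≤a) a<i)) left-edge
    ; right-edge = right-edge′
    ; base       = base′
    ; left       = embedded-∘-before {0} {a} {a + j} {k} {L} {C} {D} left eqD a<i
    ; right      = embedded-∘-inside {a} {b} {j} {k} {R} {C} {D} right eqD 1≤j j≤b
    ; crossing   = λ arc p<a+1 a+1<q →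
                     let pos = position (a + j) k (NonBaseArc.p<q arc) in
                     trans (col-∘ C D eqD pos) (crossing′ arc p<a+1 a+1<q pos)
    }

∘-isNodeˡ : ∀ {x a b i k L R C D} → IsNode x a b L R C → merge x blue ≡ x → HasBlueBase D →
            size D ≡ suc k → 1 ≤ i → i ≤ a → IsNode x (a + k) b (L ∘⟨ i ⟩ D) R (C ∘⟨ i ⟩ D)
∘-isNodeˡ {x} {a} {b} {i} {k} {L} {R} {C} {D} = GraftLeft.isNode {x} {a} {b} {i} {k} {L} {R} {C} {D}

∘-isNodeʳ : ∀ {x a b i j k L R C D} → IsNode x a b L R C → merge x blue ≡ x → HasBlueBase D →
            size D ≡ suc k → 1 ≤ j → j ≤ b → a + j ≡ i → IsNode x a (b + k) L (R ∘⟨ j ⟩ D) (C ∘⟨ i ⟩ D)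
∘-isNodeʳ {x} {a} {b} {_} {j} {k} {L} {R} {C} {D} N merge-x-blue baseD eqD 1≤j j≤b refl =
  GraftRight.isNode {x} {a} {b} {j} {k} {L} {R} {C} {D} N merge-x-blue baseD eqD 1≤j j≤b

edge-has-no-inner-arc : ∀ {p q} → ¬ NonBaseArc 1 p q
edge-has-no-inner-arc (nonBase 1≤p p<q q≤ ≢base) =
  ≢base (≤-antisym (≤-pred (≤-trans p<q q≤)) 1≤p , ≤-antisym q≤ (≤-trans (s≤s 1≤p) p<q))

τ-isNode : ∀ {x} → IsNode x 1 1 unitC unitC (τ x blue x)
τ-isNode = record
  { sizeˡ      = refl
  ; sizeʳ      = refl
  ; size≡      = refl
  ; 1≤a        = s≤s z≤n
  ; 1≤b        = s≤s z≤n
  ; left-edge  = refl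
  ; right-edge = refl
  ; base       = refl
  ; left       = ⊥-elim ∘ edge-has-no-inner-arc
  ; right      = ⊥-elim ∘ edge-has-no-inner-arc
  ; crossing   = λ (nonBase 1≤p _ q≤ ≢base) p<2 2<q →
                   ⊥-elim (≢base (≤-antisym (≤-pred p<2) 1≤p , ≤-antisym q≤ 2<q))
  }

graft-isNode : ∀ {x L R} → merge x blue ≡ x → HasBlueBase L → HasBlueBase R → 1 ≤ size L → 1 ≤ size R →
               IsNode x (size L) (size R) L R ((τ x blue x ∘⟨ 2 ⟩ R) ∘⟨ 1 ⟩ L)
graft-isNode {x} {L} {R} merge-x-blue baseL baseR 1≤l 1≤r =
  subst₂ (λ a b → IsNode x a b L R ((τ x blue x ∘⟨ 2 ⟩ R) ∘⟨ 1 ⟩ L)) (sym eqL) (sym eqR)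
    (IsNode-resp-parts grafted (∘-identityˡ eqL baseL) (∘-identityˡ eqR baseR))
  where
  eqL = ≡suc-pred 1≤l
  eqR = ≡suc-pred 1≤r
  grafted : IsNode x (1 + pred (size L)) (1 + pred (size R)) (unitC ∘⟨ 1 ⟩ L) (unitC ∘⟨ 1 ⟩ R)
                   ((τ x blue x ∘⟨ 2 ⟩ R) ∘⟨ 1 ⟩ L)
  grafted = ∘-isNodeˡ {C = τ x blue x ∘⟨ 2 ⟩ R} {D = L}
              (∘-isNodeʳ {C = τ x blue x} {D = R} τ-isNode merge-x-blue baseR eqR ≤-refl ≤-refl refl)
              merge-x-blue baseL eqL ≤-refl ≤-refl

≋-from-arcs : ∀ {n C C′} → size C ≡ n → size C′ ≡ n → HasBlueBase C → HasBlueBase C′ →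
              (∀ {p q} → NonBaseArc n p q → col C p q ≡ col C′ p q) → C ≋ C′
≋-from-arcs {n} {C} {C′} eq eq′ baseC baseC′ agree = trans eq (sym eq′) , pointwise
  where
  pointwise : ∀ p q → 1 ≤ p → p < q → q ≤ suc (size C) → col C p q ≡ col C′ p q
  pointwise p q 1≤p p<q q≤ with (p ≟ 1) ×-dec (q ≟ suc n)
  ... | yes (refl , refl) = trans (subst (λ m → col C 1 (suc m) ≡ blue) eq baseC)
                                  (sym (subst (λ m → col C′ 1 (suc m) ≡ blue) eq′ baseC′))
  ... | no ne = agree (nonBase 1≤p p<q (subst (λ m → q ≤ suc m) eq q≤) ne)

Plain : ℕ → Config → Set
Plain n E = ∀ {p q} → NonBaseArc n p q → col E p q ≡ none

plain-unitC : Plain 1 unitC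
plain-unitC = ⊥-elim ∘ edge-has-no-inner-arc

plain-node : ∀ {a b L R E} → IsNode none a b L R E → Plain a L → Plain b R → Plain (a + b) E
plain-node {a} {b} {E = E} N plainL plainR (nonBase 1≤p p<q q≤ ≢base) =
  go (nodeArc a b 1≤p p<q q≤) ≢base
  where
  open IsNode N
  go : ∀ {p q} → NodeArc a b p q → ¬ (p ≡ 1 × q ≡ suc (a + b)) → col E p q ≡ none
  go leftEdge _ = left-edge
  go rightEdge _ = right-edge
  go baseArc ≢base = ⊥-elim (≢base (refl , refl))
  go (inLeft arc) _ = trans (left arc) (plainL arc)
  go (inRight arc) _ = trans (right arc) (plainR arc)
  go (across arc p<a+1 a+1<q) _ = crossing arc p<a+1 a+1<q

blue≢none : blue ≢ none
blue≢none ()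

-- Two node structures on one configuration: a coloured arc of either cannot cross the other's split vertex.
module _ {x y a b c d L R L′ R′ E} (N : IsNode x a b L R E) (M : IsNode y c d L′ R′ E) where
  private
    module N = IsNode N
    module M = IsNode M
    a+b≡c+d : a + b ≡ c + d
    a+b≡c+d = trans (sym N.size≡) M.size≡
    c<a+b : ∀ {e} → e ≤ c → e < a + b
    c<a+b e≤c = ≤-trans (s≤s e≤c) (subst (suc c ≤_) (sym a+b≡c+d) (m<m+n c M.1≤b))

  split-≮-of-blue-right : y ≡ blue → ¬ a < c
  split-≮-of-blue-right refl a<c =
    blue≢none (trans (sym M.left-edge)
                     (N.crossing (nonBase ≤-refl (s≤s M.1≤a) (s≤s (<⇒≤ (c<a+b ≤-refl)))
                                          (λ (_ , e) → <⇒≢ (c<a+b ≤-refl) (suc-injective e)))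
                                 (s≤s N.1≤a) (s≤s a<c)))

  split-≮-of-blue-left : x ≡ blue → ¬ a < c
  split-≮-of-blue-left refl a<c =
    blue≢none (trans (sym N.right-edge)
                     (M.crossing (nonBase (s≤s z≤n) (s≤s (m<m+n a N.1≤b)) (≤-reflexive (cong suc a+b≡c+d))
                                          (λ (e , _) → <⇒≢ N.1≤a (sym (suc-injective e))))
                                 (s≤s a<c) (s≤s (c<a+b ≤-refl))))

  split-≮-of-α-left : ∀ {e f U V} → x ≡ none → IsNode blue e f U V L′ → ¬ a < c
  split-≮-of-α-left {e} {f} refl K a<c = compare-splits (<-cmp e a)
    where
    module K = IsNode K
    c≡e+f : c ≡ e + f
    c≡e+f = trans (sym M.sizeˡ) K.size≡
    e<c : e < c
    e<c = subst (e <_) (sym c≡e+f) (m<m+n e K.1≤b)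
    blue-left : col E 1 (suc e) ≡ blue
    blue-left = trans (M.left (nonBase ≤-refl (s≤s K.1≤a) (s≤s (<⇒≤ e<c))
                                       (λ (_ , e≡) → <⇒≢ e<c (suc-injective e≡))))
                      K.left-edge
    blue-right : col E (suc e) (suc c) ≡ blue
    blue-right = trans (M.left (nonBase (s≤s z≤n) (s≤s e<c) ≤-refl
                                        (λ (e≡ , _) → <⇒≢ K.1≤a (sym (suc-injective e≡)))))
                       (subst (λ n → col L′ (suc e) (suc n) ≡ blue) (sym c≡e+f) K.right-edge)
    compare-splits : Tri (e < a) (e ≡ a) (a < e) → ⊥
    compare-splits (tri≈ _ e≡a _) =
      blue≢none (trans (sym blue-left) (subst (λ n → col E 1 (suc n) ≡ none) (sym e≡a) N.left-edge))
    compare-splits (tri< e<a _ _) =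
      blue≢none (trans (sym blue-right)
                       (N.crossing (nonBase (s≤s z≤n) (s≤s e<c) (s≤s (<⇒≤ (c<a+b ≤-refl)))
                                            (λ (e≡ , _) → <⇒≢ K.1≤a (sym (suc-injective e≡))))
                                   (s≤s e<a) (s≤s a<c)))
    compare-splits (tri> _ _ a<e) =
      blue≢none (trans (sym blue-left)
                       (N.crossing (nonBase ≤-refl (s≤s K.1≤a) (s≤s (<⇒≤ (c<a+b (<⇒≤ e<c))))
                                            (λ (_ , e≡) → <⇒≢ (c<a+b (<⇒≤ e<c)) (suc-injective e≡)))
                                   (s≤s N.1≤a) (s≤s a<e)))

  same-split : a ≡ c → HasBlueBase L → HasBlueBase L′ → HasBlueBase R → HasBlueBase R′ →
               x ≡ y × L ≋ L′ × R ≋ R′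
  same-split refl baseL baseL′ baseR baseR′ with +-cancelˡ-≡ a b d a+b≡c+d
  ... | refl = trans (sym N.left-edge) M.left-edge
             , ≋-from-arcs N.sizeˡ M.sizeˡ baseL baseL′ (λ arc → trans (sym (N.left arc)) (M.left arc))
             , ≋-from-arcs N.sizeʳ M.sizeʳ baseR baseR′ (λ arc → trans (sym (N.right arc)) (M.right arc))

data Generator : Set where
  gα gβ : Generator

node : Generator → Tree → Tree → Tree
node gα = α
node gβ = β

edgeColour : Generator → Colour
edgeColour gα = blue
edgeColour gβ = none

merge-edgeColour-blue : ∀ g → merge (edgeColour g) blue ≡ edgeColour g
merge-edgeColour-blue gα = refl
merge-edgeColour-blue gβ = refl

edgeColour-injective : ∀ {g h} → edgeColour g ≡ edgeColour h → g ≡ h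
edgeColour-injective {gα} {gα} _ = refl
edgeColour-injective {gβ} {gβ} _ = refl

node-cong : ∀ {g h l l′ r r′} → g ≡ h → l ≡ l′ → r ≡ r′ → node g l r ≡ node h l′ r′
node-cong refl refl refl = refl

node-∘F-left : ∀ g l r {i} t → i ≤ arity l → node g l r ∘F⟨ i ⟩ t ≡ node g (l ∘F⟨ i ⟩ t) r
node-∘F-left gα l r t i≤a rewrite ≤ᵇ-true i≤a = refl
node-∘F-left gβ l r t i≤a rewrite ≤ᵇ-true i≤a = refl

node-∘F-right : ∀ g l r {i} t → ¬ i ≤ arity l →
                node g l r ∘F⟨ i ⟩ t ≡ node g l (r ∘F⟨ i ∸ arity l ⟩ t)
node-∘F-right gα l r t i≰a rewrite ≤ᵇ-false i≰a = refl
node-∘F-right gβ l r t i≰a rewrite ≤ᵇ-false i≰a = refl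

mutual
  π-isNode : ∀ g l r → IsNode (edgeColour g) (size (π l)) (size (π r)) (π l) (π r) (π (node g l r))
  π-isNode gα l r = graft-isNode refl (π-blueBase l) (π-blueBase r) (π-nonempty l) (π-nonempty r)
  π-isNode gβ l r = graft-isNode refl (π-blueBase l) (π-blueBase r) (π-nonempty l) (π-nonempty r)

  π-blueBase : ∀ t → HasBlueBase (π t)
  π-blueBase leaf    = refl
  π-blueBase (α l r) = IsNode-blueBase (π-isNode gα l r)
  π-blueBase (β l r) = IsNode-blueBase (π-isNode gβ l r)

  π-nonempty : ∀ t → 1 ≤ size (π t)
  π-nonempty leaf    = s≤s z≤n
  π-nonempty (α l r) = IsNode-nonempty (π-isNode gα l r)
  π-nonempty (β l r) = IsNode-nonempty (π-isNode gβ l r)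

π-size : ∀ t → size (π t) ≡ arity t
π-size leaf    = refl
π-size (α l r) = trans (IsNode.size≡ (π-isNode gα l r)) (cong₂ _+_ (π-size l) (π-size r))
π-size (β l r) = trans (IsNode.size≡ (π-isNode gβ l r)) (cong₂ _+_ (π-size l) (π-size r))

π-size≡suc : ∀ t → size (π t) ≡ suc (pred (size (π t)))
π-size≡suc t = ≡suc-pred (π-nonempty t)

mutual
  π-∘ : ∀ s i t → 1 ≤ i → i ≤ arity s → π (s ∘F⟨ i ⟩ t) ≋ (π s ∘⟨ i ⟩ π t)
  π-∘ leaf (suc zero) t _ _ = ≋-sym (∘-identityˡ (π-size≡suc t) (π-blueBase t))
  π-∘ leaf (suc (suc _)) t _ (s≤s ())
  π-∘ (α l r) = π-∘-node gα l r
  π-∘ (β l r) = π-∘-node gβ l r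

  π-∘-node : ∀ g l r i t → 1 ≤ i → i ≤ arity l + arity r →
             π (node g l r ∘F⟨ i ⟩ t) ≋ (π (node g l r) ∘⟨ i ⟩ π t)
  π-∘-node g l r i t 1≤i i≤n with i ≤? arity l
  ... | yes i≤a rewrite node-∘F-left g l r t i≤a =
    IsNode-unique (π-isNode g (l ∘F⟨ i ⟩ t) r)
                  (∘-isNodeˡ {C = π (node g l r)} {D = π t} (π-isNode g l r) (merge-edgeColour-blue g)
                             (π-blueBase t) (π-size≡suc t) 1≤i
                             (subst (i ≤_) (sym (π-size l)) i≤a))
                  (π-∘ l i t 1≤i i≤a) ≋-refl
  ... | no i≰a rewrite node-∘F-right g l r t i≰a =
    IsNode-unique (π-isNode g l (r ∘F⟨ j ⟩ t))
                  (∘-isNodeʳ {C = π (node g l r)} {D = π t} (π-isNode g l r) (merge-edgeColour-blue g)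
                             (π-blueBase t) (π-size≡suc t) 1≤j (subst (j ≤_) (sym (π-size r)) j≤b) a+j≡i)
                  ≋-refl (π-∘ r j t 1≤j j≤b)
    where
    j = i ∸ arity l
    1≤j = m<n⇒0<n∸m (≰⇒> i≰a)
    j≤b = m≤n+o⇒m∸n≤o i (arity l) i≤n
    a+j≡i : size (π l) + j ≡ i
    a+j≡i = trans (cong (_+ j) (π-size l)) (m+[n∸m]≡n (<⇒≤ (≰⇒> i≰a)))

π-∘-resp-≋ : ∀ {s s′ t t′} i → 1 ≤ i → i ≤ arity s → π s ≋ π s′ → π t ≋ π t′ →
             π (s ∘F⟨ i ⟩ t) ≋ π (s′ ∘F⟨ i ⟩ t′)
π-∘-resp-≋ {s} {s′} {t} {t′} i 1≤i i≤s s≋ t≋ = begin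
  π (s ∘F⟨ i ⟩ t)        ≈⟨ π-∘ s i t 1≤i i≤s ⟩
  π s ∘⟨ i ⟩ π t          ≈⟨ ∘-resp-≋ s≋ t≋ (π-size≡suc t) 1≤i (subst (i ≤_) (sym (π-size s)) i≤s) ⟩
  π s′ ∘⟨ i ⟩ π t′        ≈⟨ π-∘ s′ i t′ 1≤i i≤s′ ⟨
  π (s′ ∘F⟨ i ⟩ t′)      ∎
  where
  open SetoidReasoning ≋-setoid
  i≤s′ = subst (i ≤_) (trans (sym (π-size s)) (trans (proj₁ s≋) (π-size s′))) i≤s

π-β-associative : π (βF ∘F⟨ 1 ⟩ βF) ≋ π (βF ∘F⟨ 2 ⟩ βF)
π-β-associative = ≋-from-arcs refl refl refl refl (λ arc → trans (plain-βˡ arc) (sym (plain-βʳ arc)))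
  where
  plain-β : Plain 2 (π βF)
  plain-β = plain-node (π-isNode gβ leaf leaf) plain-unitC plain-unitC
  plain-βˡ : Plain 3 (π (β βF leaf))
  plain-βˡ = plain-node (π-isNode gβ βF leaf) plain-β plain-unitC
  plain-βʳ : Plain 3 (π (β leaf βF))
  plain-βʳ = plain-node (π-isNode gβ leaf βF) plain-unitC plain-β

π-resp-≡F : ∀ {s t} → s ≡F t → π s ≋ π t
π-resp-≡F rel                          = π-β-associative
π-resp-≡F refl'                        = ≋-refl
π-resp-≡F (sym' s≡t)                   = ≋-sym (π-resp-≡F s≡t)
π-resp-≡F (trans' s≡t t≡u)             = ≋-trans (π-resp-≡F s≡t) (π-resp-≡F t≡u)
π-resp-≡F (comp' {s} {s′} {t} {t′} i 1≤i i≤s s≡s′ t≡t′) =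
  π-∘-resp-≋ {s} {s′} {t} {t′} i 1≤i i≤s (π-resp-≡F s≡s′) (π-resp-≡F t≡t′)

data NotβRooted : Tree → Set where
  leaf-root : NotβRooted leaf
  α-root    : ∀ {l r} → NotβRooted (α l r)

data Normal : Tree → Set where
  leaf : Normal leaf
  α    : ∀ {l r} → Normal l → Normal r → Normal (α l r)
  β    : ∀ {l r} → NotβRooted l → Normal l → Normal r → Normal (β l r)

β-rebracket : Tree → Tree → Tree
β-rebracket leaf    y = β leaf y
β-rebracket (α l r) y = β (α l r) y
β-rebracket (β l r) y = β-rebracket l (β-rebracket r y)

normalise : Tree → Tree
normalise leaf    = leaf
normalise (α s t) = α (normalise s) (normalise t)
normalise (β s t) = β-rebracket (normalise s) (normalise t)

β-rebracket-Normal : ∀ {x y} → Normal x → Normal y → Normal (β-rebracket x y)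
β-rebracket-Normal leaf            ny = β leaf-root leaf ny
β-rebracket-Normal (α nl nr)       ny = β α-root (α nl nr) ny
β-rebracket-Normal (β _ nl nr)     ny = β-rebracket-Normal nl (β-rebracket-Normal nr ny)

normalise-Normal : ∀ t → Normal (normalise t)
normalise-Normal leaf    = leaf
normalise-Normal (α s t) = α (normalise-Normal s) (normalise-Normal t)
normalise-Normal (β s t) = β-rebracket-Normal (normalise-Normal s) (normalise-Normal t)

α-cong : ∀ {s s′ t t′} → s ≡F s′ → t ≡F t′ → α s t ≡F α s′ t′
α-cong {s} {s′} {t} {t′} s≡ t≡ =
  comp' {αF ∘F⟨ 2 ⟩ t} {αF ∘F⟨ 2 ⟩ t′} 1 ≤-refl (s≤s z≤n) (comp' {αF} {αF} 2 (s≤s z≤n) ≤-refl refl' t≡) s≡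

β-cong : ∀ {s s′ t t′} → s ≡F s′ → t ≡F t′ → β s t ≡F β s′ t′
β-cong {s} {s′} {t} {t′} s≡ t≡ =
  comp' {βF ∘F⟨ 2 ⟩ t} {βF ∘F⟨ 2 ⟩ t′} 1 ≤-refl (s≤s z≤n) (comp' {βF} {βF} 2 (s≤s z≤n) ≤-refl refl' t≡) s≡

-- β (β a b) c and β a (β b c) are (((β ∘₁ β) ∘₃ c) ∘₂ b) ∘₁ a and (((β ∘₂ β) ∘₃ c) ∘₂ b) ∘₁ a.
β-assoc : ∀ a b c → β (β a b) c ≡F β a (β b c)
β-assoc a b c =
  comp' 1 ≤-refl (s≤s z≤n)
        (comp' 2 (s≤s z≤n) (m≤m+n 2 (arity c)) (comp' 3 (s≤s z≤n) ≤-refl rel (refl' {c})) (refl' {b}))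
        (refl' {a})

β≡F-β-rebracket : ∀ x y → β x y ≡F β-rebracket x y
β≡F-β-rebracket leaf    y = refl'
β≡F-β-rebracket (α l r) y = refl'
β≡F-β-rebracket (β l r) y =
  trans' (β-assoc l r y) (trans' (β-cong refl' (β≡F-β-rebracket r y)) (β≡F-β-rebracket l (β-rebracket r y)))

≡F-normalise : ∀ t → t ≡F normalise t
≡F-normalise leaf    = refl'
≡F-normalise (α s t) = α-cong (≡F-normalise s) (≡F-normalise t)
≡F-normalise (β s t) =
  trans' (β-cong (≡F-normalise s) (≡F-normalise t)) (β≡F-β-rebracket (normalise s) (normalise t))

Admissible : Generator → Tree → Set
Admissible gα _ = ⊤
Admissible gβ l = NotβRooted l

split-≮ : ∀ g h {a b d L R R′ E} t → IsNode (edgeColour g) a b L R E →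
          IsNode (edgeColour h) (size (π t)) d (π t) R′ E → Admissible h t → ¬ a < size (π t)
split-≮ g  gα _       N M _         = split-≮-of-blue-right N M refl
split-≮ gα gβ _       N M _         = split-≮-of-blue-left N M refl
split-≮ gβ gβ leaf    N M leaf-root = λ a<1 → <⇒≱ a<1 (IsNode.1≤a N)
split-≮ gβ gβ (α u v) N M α-root    = split-≮-of-α-left N M refl (π-isNode gα u v)

mutual
  π-injective : ∀ {s t} → Normal s → Normal t → π s ≋ π t → s ≡ t
  π-injective leaf          leaf          _       = refl
  π-injective leaf          (α {l} {r} _ _)   (e , _) = ⊥-elim (IsNode-size≢1 (π-isNode gα l r) (sym e))
  π-injective leaf          (β {l} {r} _ _ _) (e , _) = ⊥-elim (IsNode-size≢1 (π-isNode gβ l r) (sym e))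
  π-injective (α {l} {r} _ _)   leaf      (e , _) = ⊥-elim (IsNode-size≢1 (π-isNode gα l r) e)
  π-injective (β {l} {r} _ _ _) leaf      (e , _) = ⊥-elim (IsNode-size≢1 (π-isNode gβ l r) e)
  π-injective (α ns₁ ns₂)      (α nt₁ nt₂)      = π-injective-node gα gα tt tt ns₁ ns₂ nt₁ nt₂
  π-injective (α ns₁ ns₂)      (β at nt₁ nt₂)   = π-injective-node gα gβ tt at ns₁ ns₂ nt₁ nt₂
  π-injective (β as ns₁ ns₂)   (α nt₁ nt₂)      = π-injective-node gβ gα as tt ns₁ ns₂ nt₁ nt₂
  π-injective (β as ns₁ ns₂)   (β at nt₁ nt₂)   = π-injective-node gβ gβ as at ns₁ ns₂ nt₁ nt₂

  π-injective-node : ∀ g h {s₁ s₂ t₁ t₂} → Admissible g s₁ → Admissible h t₁ →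
                     Normal s₁ → Normal s₂ → Normal t₁ → Normal t₂ →
                     π (node g s₁ s₂) ≋ π (node h t₁ t₂) → node g s₁ s₂ ≡ node h t₁ t₂
  π-injective-node g h {s₁} {s₂} {t₁} {t₂} as at ns₁ ns₂ nt₁ nt₂ π≋ =
    by-splits (<-cmp (size (π s₁)) (size (π t₁)))
    where
    N = IsNode-resp-≋ (π-isNode g s₁ s₂) π≋
    M = π-isNode h t₁ t₂
    by-splits : Tri _ _ _ → node g s₁ s₂ ≡ node h t₁ t₂
    by-splits (tri< a<c _ _) = ⊥-elim (split-≮ g h t₁ N M at a<c)
    by-splits (tri> _ _ c<a) = ⊥-elim (split-≮ h g s₁ M N as c<a)
    by-splits (tri≈ _ a≡c _)
      with same-split N M a≡c (π-blueBase s₁) (π-blueBase t₁) (π-blueBase s₂) (π-blueBase t₂)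
    ... | x≡y , s₁≋t₁ , s₂≋t₂ =
      node-cong (edgeColour-injective x≡y) (π-injective ns₁ nt₁ s₁≋t₁) (π-injective ns₂ nt₂ s₂≋t₂)

π-reflects-≡F : ∀ {s t} → π s ≋ π t → s ≡F t
π-reflects-≡F {s} {t} π≋ =
  trans' (≡F-normalise s) (subst (_≡F t) (sym same-normal-form) (sym' (≡F-normalise t)))
  where
  same-normal-form : normalise s ≡ normalise t
  same-normal-form =
    π-injective (normalise-Normal s) (normalise-Normal t)
      (≋-trans (π-resp-≡F (sym' (≡F-normalise s))) (≋-trans π≋ (π-resp-≡F (≡F-normalise t))))

π-generated : ∀ t → InGen (π t)
π-generated leaf    = gen-unit
π-generated (α s t) =
  gen-comp 1 ≤-refl (s≤s z≤n) (gen-comp 2 (s≤s z≤n) ≤-refl gen-aaa (π-generated t)) (π-generated s)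
π-generated (β s t) =
  gen-comp 1 ≤-refl (s≤s z≤n) (gen-comp 2 (s≤s z≤n) ≤-refl gen-bab (π-generated t)) (π-generated s)

π-generator : ∀ g → π (node g leaf leaf) ≋ τ (edgeColour g) blue (edgeColour g)
π-generator g = IsNode-unique (π-isNode g leaf leaf) τ-isNode ≋-refl ≋-refl

generated⇒π-image : ∀ {C} → InGen C → Σ Tree (λ t → π t ≋ C)
generated⇒π-image gen-unit = leaf , ≋-refl
generated⇒π-image gen-aaa  = αF , π-generator gα
generated⇒π-image gen-bab  = βF , π-generator gβ
generated⇒π-image (gen-comp i 1≤i i≤C genC genD)
  with generated⇒π-image genC | generated⇒π-image genD
... | s , πs≋C | t , πt≋D =
  s ∘F⟨ i ⟩ t , ≋-trans (π-∘ s i t 1≤i i≤s)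
                        (∘-resp-≋ πs≋C πt≋D (π-size≡suc t) 1≤i (subst (i ≤_) (sym (proj₁ πs≋C)) i≤C))
  where i≤s = subst (i ≤_) (trans (sym (proj₁ πs≋C)) (π-size s)) i≤C
generated⇒π-image (gen-resp C≋D genC) with generated⇒π-image genC
... | t , πt≋C = t , ≋-trans πt≋C C≋D

mainTheorem14 : ((s t : Tree) → (π s ≋ π t) ⇔ (s ≡F t))
                × ((C : Config) → InGen C ⇔ Σ Tree (λ t → π t ≋ C))
mainTheorem14 = (λ s t → mk⇔ π-reflects-≡F π-resp-≡F)
              , (λ C → mk⇔ generated⇒π-image (λ (t , πt≋C) → gen-resp πt≋C (π-generated t)))
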